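{- Let $S$ be as in the context and suppose that $|\Pi_1|$ is odd. For $u\in F_2^n$ let $k=|\Pi_1\cap\Delta(u)|$. Then $$\mathbf{s_n}u=\begin{cases}u, & \text{if } k \text{ is even};\\ u+\sum_{\overline i\in\Pi_0}\overline i, & \text{if } k \text{ is odd}.\end{cases}$$ In particular, $$sw(\mathbf{s_n}u)=\begin{cases}sw(u), & \text{if } k \text{ is even};\\ n-|\Pi_1|+2k-sw(u), & \text{if } k \text{ is odd}.\end{cases}$$
   Context: $S$ is a finite simple connected graph with vertex set $\{s_1,\dots,s_n\}$, $n\ge2$, and edge set $R$, such that $s_1,\dots,s_{n-1}$ is an induced path; $s_n$ is adjacent to some of $s_1,\dots,s_{n-1}$. $\widetilde s$ is the characteristic vector in $F_2^n$ (coordinates indexed by vertices) of vertex $s$. The flipping move of $s$ is $\mathbf s\in\mathrm{Mat}_n(F_2)$ with $\mathbf s_{ab}=1$ if $a=b$, or if $b=s$ and $ab\in R$, and $0$ otherwise. $\overline1=\widetilde s_1$ and $\overline{i+1}=\mathbf{s_i}\cdots\mathbf{s_1}\overline1$ for $1\le i\le n-1$. $\Pi=\{\overline1,\dots,\overline n\}$, $\Pi_0=\{\overline i\in\Pi:\langle\overline i,\widetilde s_n\rangle=0\}$ (dot product over $F_2$), and $\Pi_1=\Pi\setminus\Pi_0$. When $|\Pi_1|$ is odd, $\Delta=\Pi$ is a basis of $F_2^n$. $\Delta(u)$ is the subset of $\Delta$ with $u=\sum_{x\in\Delta(u)}x$, and $sw(u)=|\Delta(u)|$. -}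

module Defs where

open import Data.Nat using (ℕ; zero; suc; _<_; _+_; s≤s; z≤n)
open import Data.Nat.Properties using (<-trans; n<1+n)
open import Data.Fin using (Fin; toℕ; fromℕ; fromℕ<; inject₁; _≟_)
open import Data.Fin.Properties using (toℕ<n)
open import Data.Bool using (Bool; true; false; not; _∧_; _∨_; _xor_; if_then_else_)
open import Data.Vec.Functional using (foldr)
open import Relation.Nullary.Decidable using (⌊_⌋)
open import Relation.Binary.PropositionalEquality using (_≡_)
open import Data.Sum using (_⊎_)
open import Data.Product using (_×_)

-- Vectors of F₂ⁿ: functions Fin n → Bool (true = 1, xor = addition, ∧ = multiplication).
-- Subsets of Fin n are also represented by their indicator functions Fin n → Bool.
Vec₂ : ℕ → Set
Vec₂ n = Fin n → Bool

Mat₂ : ℕ → Set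
Mat₂ n = Fin n → Fin n → Bool

Σ₂ : ∀ {n} → (Fin n → Bool) → Bool
Σ₂ f = foldr _xor_ false f

_+ᵥ_ : ∀ {n} → Vec₂ n → Vec₂ n → Vec₂ n
(u +ᵥ v) a = u a xor v a

_·_ : ∀ {n} → Mat₂ n → Vec₂ n → Vec₂ n
(M · u) a = Σ₂ (λ b → M a b ∧ u b)

⟨_,_⟩ : ∀ {n} → Vec₂ n → Vec₂ n → Bool
⟨ u , v ⟩ = Σ₂ (λ a → u a ∧ v a)

χ : ∀ {n} → Fin n → Vec₂ n
χ s a = ⌊ a ≟ s ⌋

count : ∀ {n} → (Fin n → Bool) → ℕ
count f = foldr (λ b k → if b then suc k else k) 0 f

sumOver : ∀ {n} → (Fin n → Bool) → (Fin n → Vec₂ n) → Vec₂ n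
sumOver D x a = Σ₂ (λ i → D i ∧ x i a)

data Reach {n : ℕ} (adj : Fin n → Fin n → Bool) : Fin n → Fin n → Set where
  here : ∀ {a} → Reach adj a a
  step : ∀ {a b c} → adj a b ≡ true → Reach adj b c → Reach adj a c

-- The graph S on vertices s₁,…,sₙ, with n = suc m; vertex sᵢ is the element
-- i-1 of Fin (suc m), so s₁,…,s_{n-1} are inject₁ i (i : Fin m) and sₙ = fromℕ m.
record SGraph (m : ℕ) : Set where
  field
    adj        : Fin (suc m) → Fin (suc m) → Bool
    adj-sym    : ∀ a b → adj a b ≡ adj b a
    adj-irrefl : ∀ a → adj a a ≡ false
    adj-path   : ∀ (i j : Fin m) →
                   adj (inject₁ i) (inject₁ j) ≡ true
                   → (suc (toℕ i) ≡ toℕ j ⊎ suc (toℕ j) ≡ toℕ i)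
    path-adj   : ∀ (i j : Fin m) →
                   (suc (toℕ i) ≡ toℕ j ⊎ suc (toℕ j) ≡ toℕ i)
                   → adj (inject₁ i) (inject₁ j) ≡ true
    connected  : ∀ a b → Reach adj a b

module _ {m : ℕ} (S : SGraph m) where
  open SGraph S

  flipMat : Fin (suc m) → Mat₂ (suc m)
  flipMat s a b = ⌊ a ≟ b ⌋ ∨ (⌊ b ≟ s ⌋ ∧ adj a b)

  -- barℕ k = overline{k+1}:  overline1 = χ s₁,  overline{i+1} = sᵢ overline i
  barℕ : (k : ℕ) → k < suc m → Vec₂ (suc m)
  barℕ zero    _ = χ (fromℕ< (s≤s z≤n))
  barℕ (suc k) p = flipMat (fromℕ< (<-trans (n<1+n k) p)) · barℕ k (<-trans (n<1+n k) p)

  -- bar i = overline{i+1} for i : Fin n (0-indexed)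
  bar : Fin (suc m) → Vec₂ (suc m)
  bar i = barℕ (toℕ i) (toℕ<n i)

  sn : Fin (suc m)
  sn = fromℕ m

  inΠ₁ : Fin (suc m) → Bool
  inΠ₁ i = ⟨ bar i , χ sn ⟩

  sumΠ₀ : Vec₂ (suc m)
  sumΠ₀ = sumOver (λ i → not (inΠ₁ i)) bar

-- On the path coordinates s₁,…,s_{n-1}, the vector overline k is e_{s_{k-1}} + e_{s_k}
-- (overline 1 = e_{s₁}), and its sₙ-coordinate says whether overline k ∈ Π₁. So a combination
-- ∑_{i ∈ D} overline i has path coordinates D_{k} + D_{k+1}: it vanishes only for constant D,
-- and then its sₙ-coordinate is that constant times |Π₁|. Hence Π is a basis when |Π₁| is odd.
-- The flip at sₙ adds u(sₙ) = |Π₁ ∩ Δ(u)| mod 2 times the neighbourhood column of sₙ, and the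
-- same path computation identifies that column with ∑_{Π₀}. Thus Δ(sₙu) = Δ(u) + Π₀ in the odd
-- case, whose size is |Π₀| + 2k − sw(u).
module Submission where

open import Defs
open import Algebra.Bundles using (CommutativeRing)
open import Data.Bool using (Bool; true; false; not; _∧_; _∨_; _xor_; if_then_else_)
open import Data.Bool.Properties
  using ( xor-∧-commutativeRing; ∧-comm; ∧-assoc; ∧-zeroʳ; ∧-identityʳ; ∧-inverseʳ
        ; ∧-distribˡ-xor; ∧-distribʳ-xor; ∨-identityʳ; xor-identityʳ; xor-same
        ; not-involutive; ¬-not )
open import Data.Fin using (Fin; zero; suc; inject₁; fromℕ; fromℕ<; toℕ; _≟_)
open import Data.Fin.Properties using (toℕ-injective; toℕ-inject₁; toℕ-fromℕ<; toℕ<n)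
open import Data.Fin.Induction using (<-weakInduction)
open import Data.Nat using (ℕ; zero; suc; _+_; _*_; _∸_; _≤_; _<_; z≤n; s≤s)
open import Data.Nat.Divisibility using (_∣_; divides)
open import Data.Nat.Properties
  using (+-0-commutativeMonoid; +-*-semiring; <-irrelevant; <-trans; n<1+n; m≤n⇒m≤1+n; +-∸-comm; m+n∸n≡m)
open import Data.Product using (_×_; _,_; ∃)
open import Data.Sum using (_⊎_; inj₁; inj₂; [_,_]′)
import Data.Sum as Sum
open import Function using (_∘_)
open import Relation.Nullary using (¬_; contradiction)
open import Relation.Nullary.Decidable using (⌊_⌋; does; yes; no; isYes≗does; dec-true; dec-false)
open import Relation.Binary.PropositionalEquality
open ≡-Reasoning
import Algebra.Properties.CommutativeMonoid.Sum as CommutativeMonoidSum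
import Algebra.Properties.Semiring.Sum as SemiringSum

-- Σ₂ and count are, up to bit, the library sums of the rings F₂ = (Bool, xor, ∧) and ℕ.
module F₂ = CommutativeRing xor-∧-commutativeRing
module F₂Σ = CommutativeMonoidSum F₂.+-commutativeMonoid
module F₂Σ* = SemiringSum F₂.semiring
module ℕΣ = CommutativeMonoidSum +-0-commutativeMonoid
module ℕΣ* = SemiringSum +-*-semiring

Σ₂-cong : ∀ {n} {f g : Fin n → Bool} → f ≗ g → Σ₂ f ≡ Σ₂ g
Σ₂-cong = F₂Σ.sum-cong-≗

Σ₂-xor : ∀ {n} (f g : Fin n → Bool) → Σ₂ (λ i → f i xor g i) ≡ Σ₂ f xor Σ₂ g
Σ₂-xor = F₂Σ.∑-distrib-+

Σ₂-false : ∀ n → Σ₂ {n} (λ _ → false) ≡ false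
Σ₂-false = F₂Σ.sum-replicate-zero

-- ⌊_⌋ does not compute through the map′ in the definition of _≟_ on suc, whereas does does;
-- the computations along the path are therefore phrased with does.
⌊suc≟suc⌋ : ∀ {n} (a b : Fin n) → ⌊ suc a ≟ suc b ⌋ ≡ ⌊ a ≟ b ⌋
⌊suc≟suc⌋ a b = trans (isYes≗does (suc a ≟ suc b)) (sym (isYes≗does (a ≟ b)))

⟨-,χ⟩ : ∀ {n} (f : Vec₂ n) c → ⟨ f , χ c ⟩ ≡ f c
⟨-,χ⟩ {suc n} f zero = begin
    (f zero ∧ true) xor Σ₂ (λ a → f (suc a) ∧ false)
  ≡⟨ cong₂ _xor_ (∧-identityʳ (f zero)) (Σ₂-cong (∧-zeroʳ ∘ f ∘ suc)) ⟩
    f zero xor Σ₂ {n} (λ _ → false)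
  ≡⟨ cong (f zero xor_) (Σ₂-false n) ⟩
    f zero xor false
  ≡⟨ xor-identityʳ (f zero) ⟩
    f zero ∎
⟨-,χ⟩ {suc n} f (suc c) = begin
    (f zero ∧ false) xor Σ₂ (λ a → f (suc a) ∧ ⌊ suc a ≟ suc c ⌋)
  ≡⟨ cong₂ _xor_ (∧-zeroʳ (f zero)) (Σ₂-cong λ a → cong (f (suc a) ∧_) (⌊suc≟suc⌋ a c)) ⟩
    ⟨ f ∘ suc , χ c ⟩
  ≡⟨ ⟨-,χ⟩ (f ∘ suc) c ⟩
    f (suc c) ∎

sumOver-xor : ∀ {n} (D D' : Fin n → Bool) (x : Fin n → Vec₂ n) a →
  sumOver (λ i → D i xor D' i) x a ≡ sumOver D x a xor sumOver D' x a
sumOver-xor D D' x a =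
  trans (Σ₂-cong λ i → ∧-distribʳ-xor (x i a) (D i) (D' i)) (Σ₂-xor (λ i → D i ∧ x i a) (λ i → D' i ∧ x i a))

xor≡false⇒≡ : ∀ {x y} → x xor y ≡ false → x ≡ y
xor≡false⇒≡ {false} {false} _ = refl
xor≡false⇒≡ {true}  {true}  _ = refl

isOdd : ℕ → Bool
isOdd zero    = false
isOdd (suc n) = not (isOdd n)

Σ₂-parity : ∀ {n} (f : Fin n → Bool) → Σ₂ f ≡ isOdd (count f)
Σ₂-parity {zero}  f = refl
Σ₂-parity {suc n} f with f zero
... | true  = cong not (Σ₂-parity (f ∘ suc))
... | false = Σ₂-parity (f ∘ suc)

isOdd-*2 : ∀ q → isOdd (q * 2) ≡ false
isOdd-*2 zero    = refl
isOdd-*2 (suc q) = trans (not-involutive _) (isOdd-*2 q)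

even⊎isOdd : ∀ n → 2 ∣ n ⊎ isOdd n ≡ true
even⊎isOdd zero          = inj₁ (divides 0 refl)
even⊎isOdd (suc zero)    = inj₂ refl
even⊎isOdd (suc (suc n)) =
  Sum.map (λ { (divides q refl) → divides (suc q) refl }) (trans (not-involutive _)) (even⊎isOdd n)

Σ₂-even : ∀ {n} (f : Fin n → Bool) → 2 ∣ count f → Σ₂ f ≡ false
Σ₂-even f (divides q eq) = trans (Σ₂-parity f) (trans (cong isOdd eq) (isOdd-*2 q))

Σ₂-odd : ∀ {n} (f : Fin n → Bool) → ¬ 2 ∣ count f → Σ₂ f ≡ true
Σ₂-odd f odd =
  trans (Σ₂-parity f) ([ (λ even → contradiction even odd) , (λ t → t) ]′ (even⊎isOdd (count f)))

bit : Bool → ℕ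
bit b = if b then 1 else 0

count≡∑bit : ∀ {n} (f : Fin n → Bool) → count f ≡ ℕΣ.sum (bit ∘ f)
count≡∑bit {zero}  f = refl
count≡∑bit {suc n} f with f zero
... | true  = cong suc (count≡∑bit (f ∘ suc))
... | false = count≡∑bit (f ∘ suc)

count-cong : ∀ {n} {f g : Fin n → Bool} → f ≗ g → count f ≡ count g
count-cong {f = f} {g} f≗g = begin
  count f               ≡⟨ count≡∑bit f ⟩
  ℕΣ.sum (bit ∘ f)      ≡⟨ ℕΣ.sum-cong-≗ (cong bit ∘ f≗g) ⟩
  ℕΣ.sum (bit ∘ g)      ≡⟨ count≡∑bit g ⟨
  count g               ∎

count-true : ∀ n → count {n} (λ _ → true) ≡ n
count-true zero    = refl
count-true (suc n) = cong suc (count-true n)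

count≤n : ∀ {n} (f : Fin n → Bool) → count f ≤ n
count≤n {zero}  f = z≤n
count≤n {suc n} f with f zero
... | true  = s≤s (count≤n (f ∘ suc))
... | false = m≤n⇒m≤1+n (count≤n (f ∘ suc))

count-xor-not : ∀ {n} (D P : Fin n → Bool) →
  count (λ i → D i xor not (P i)) + count D + count P ≡ n + 2 * count (λ i → P i ∧ D i)
count-xor-not {n} D P = begin
    count D' + count D + count P
  ≡⟨ cong₂ _+_ (cong₂ _+_ (count≡∑bit D') (count≡∑bit D)) (count≡∑bit P) ⟩
    ∑ (bit ∘ D') + ∑ (bit ∘ D) + ∑ (bit ∘ P)
  ≡⟨ trans (ℕΣ.∑-distrib-+ (λ i → bit (D' i) + bit (D i)) (bit ∘ P))
                (cong (_+ ∑ (bit ∘ P)) (ℕΣ.∑-distrib-+ (bit ∘ D') (bit ∘ D))) ⟨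
    ∑ (λ i → bit (D' i) + bit (D i) + bit (P i))
  ≡⟨ ℕΣ.sum-cong-≗ (λ i → bits (D i) (P i)) ⟩
    ∑ (λ i → 1 + 2 * bit (P i ∧ D i))
  ≡⟨ ℕΣ.∑-distrib-+ (λ _ → 1) (λ i → 2 * bit (K i)) ⟩
    ∑ (λ _ → 1) + ∑ (λ i → 2 * bit (P i ∧ D i))
  ≡⟨ cong₂ _+_ (trans (sym (count-true n)) (count≡∑bit {n} (λ _ → true))) (ℕΣ*.*-distribˡ-sum 2 (bit ∘ K)) ⟨
    n + 2 * ∑ (bit ∘ K)
  ≡⟨ cong (λ k → n + 2 * k) (count≡∑bit K) ⟨
    n + 2 * count K ∎
  where
  ∑ : (Fin n → ℕ) → ℕ
  ∑ = ℕΣ.sum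
  D' K : Fin n → Bool
  D' i = D i xor not (P i)
  K i = P i ∧ D i
  bits : ∀ d p → bit (d xor not p) + bit d + bit p ≡ 1 + 2 * bit (p ∧ d)
  bits true  true  = refl
  bits true  false = refl
  bits false true  = refl
  bits false false = refl

m+n+o≡p+2q⇒m≡p∸o+2q∸n : ∀ {m n o p q} → m + n + o ≡ p + 2 * q → o ≤ p → m ≡ p ∸ o + 2 * q ∸ n
m+n+o≡p+2q⇒m≡p∸o+2q∸n {m} {n} {o} {p} {q} eq o≤p = sym (begin
  p ∸ o + 2 * q ∸ n      ≡⟨ cong (_∸ n) (+-∸-comm (2 * q) o≤p) ⟨
  p + 2 * q ∸ o ∸ n      ≡⟨ cong (λ y → y ∸ o ∸ n) eq ⟨
  m + n + o ∸ o ∸ n      ≡⟨ cong (_∸ n) (m+n∸n≡m (m + n) o) ⟩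
  m + n ∸ n              ≡⟨ m+n∸n≡m m n ⟩
  m                      ∎)

last-or-inject₁ : ∀ {m} (a : Fin (suc m)) → a ≡ fromℕ m ⊎ ∃ λ j → a ≡ inject₁ j
last-or-inject₁ {zero}  zero    = inj₁ refl
last-or-inject₁ {suc m} zero    = inj₂ (zero , refl)
last-or-inject₁ {suc m} (suc a) =
  Sum.map (cong suc) (λ { (j , refl) → suc j , refl }) (last-or-inject₁ a)

consecutive : ∀ {n} → Fin n → Fin n → Bool
consecutive i j = does (inject₁ j ≟ suc i) ∨ does (suc j ≟ inject₁ i)

inject₁≡suc⇒toℕ : ∀ {n} {i j : Fin n} → inject₁ j ≡ suc i → suc (toℕ i) ≡ toℕ j
inject₁≡suc⇒toℕ {j = j} e = trans (cong toℕ (sym e)) (toℕ-inject₁ j)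

toℕ⇒inject₁≡suc : ∀ {n} {i j : Fin n} → suc (toℕ i) ≡ toℕ j → inject₁ j ≡ suc i
toℕ⇒inject₁≡suc {j = j} e = toℕ-injective (trans (toℕ-inject₁ j) (sym e))

does-diagonal : ∀ {n} (i : Fin n) → does (inject₁ i ≟ inject₁ i) xor does (inject₁ i ≟ suc i) ≡ true
does-diagonal zero    = refl
does-diagonal (suc i) = does-diagonal i

does-path-step : ∀ {n} (i j : Fin n) →
  (does (inject₁ i ≟ inject₁ j) xor does (inject₁ i ≟ suc j)) xor consecutive j i
    ≡ does (suc i ≟ inject₁ j) xor does (suc i ≟ suc j)
does-path-step zero    zero    = refl
does-path-step zero    (suc j) = sym (xor-identityʳ _)
does-path-step (suc i) zero    =
  trans (cong (does (inject₁ i ≟ zero) xor_) (∨-identityʳ _)) (xor-same (does (inject₁ i ≟ zero)))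
does-path-step (suc i) (suc j) = does-path-step i j

module _ {m : ℕ} (S : SGraph m) where
  open SGraph S

  flip-· : ∀ s (u : Vec₂ (suc m)) a → (flipMat S s · u) a ≡ u a xor (adj a s ∧ u s)
  flip-· s u a = begin
      Σ₂ (λ b → (⌊ a ≟ b ⌋ ∨ (χ s b ∧ adj a b)) ∧ u b)
    ≡⟨ Σ₂-cong entry ⟩
      Σ₂ (λ b → (u b ∧ χ a b) xor ((adj a b ∧ u b) ∧ χ s b))
    ≡⟨ Σ₂-xor (λ b → u b ∧ χ a b) (λ b → (adj a b ∧ u b) ∧ χ s b) ⟩
      ⟨ u , χ a ⟩ xor ⟨ (λ b → adj a b ∧ u b) , χ s ⟩
    ≡⟨ cong₂ _xor_ (⟨-,χ⟩ u a) (⟨-,χ⟩ (λ b → adj a b ∧ u b) s) ⟩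
      u a xor (adj a s ∧ u s) ∎
    where
    entry : ∀ b → (⌊ a ≟ b ⌋ ∨ (χ s b ∧ adj a b)) ∧ u b ≡ (u b ∧ χ a b) xor ((adj a b ∧ u b) ∧ χ s b)
    entry b with a ≟ b
    ... | yes refl rewrite isYes≗does (a ≟ a) | dec-true (a ≟ a) refl | adj-irrefl a =
      sym (trans (xor-identityʳ _) (∧-identityʳ (u a)))
    ... | no a≢b rewrite isYes≗does (b ≟ a) | dec-false (b ≟ a) (a≢b ∘ sym) | ∧-zeroʳ (u b) =
      trans (∧-assoc (χ s b) (adj a b) (u b)) (∧-comm (χ s b) _)

  barℕ-cong : ∀ {k l} (p : k < suc m) (q : l < suc m) → k ≡ l → barℕ S k p ≡ barℕ S l q
  barℕ-cong p q refl = cong (barℕ S _) (<-irrelevant p q)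

  bar-suc : ∀ (i : Fin m) a →
    bar S (suc i) a ≡ bar S (inject₁ i) a xor (adj a (inject₁ i) ∧ bar S (inject₁ i) (inject₁ i))
  bar-suc i a = begin
      (flipMat S (fromℕ< p) · barℕ S (toℕ i) p) a
    ≡⟨ cong₂ (λ v w → (flipMat S v · w) a)
             vertex (barℕ-cong p (toℕ<n (inject₁ i)) (sym (toℕ-inject₁ i))) ⟩
      (flipMat S (inject₁ i) · bar S (inject₁ i)) a
    ≡⟨ flip-· (inject₁ i) (bar S (inject₁ i)) a ⟩
      bar S (inject₁ i) a xor (adj a (inject₁ i) ∧ bar S (inject₁ i) (inject₁ i)) ∎
    where
    p : toℕ i < suc m
    p = <-trans (n<1+n (toℕ i)) (toℕ<n (suc i))
    vertex : fromℕ< p ≡ inject₁ i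
    vertex = toℕ-injective (trans (toℕ-fromℕ< p) (sym (toℕ-inject₁ i)))

  adj-inject₁ : ∀ i j → adj (inject₁ i) (inject₁ j) ≡ consecutive i j
  adj-inject₁ i j with inject₁ j ≟ suc i | suc j ≟ inject₁ i
  ... | yes j≡1+i | _        = path-adj i j (inj₁ (inject₁≡suc⇒toℕ j≡1+i))
  ... | no _      | yes 1+j≡i = path-adj i j (inj₂ (inject₁≡suc⇒toℕ (sym 1+j≡i)))
  ... | no j≢1+i  | no 1+j≢i  = ¬-not λ adjacent →
    [ j≢1+i ∘ toℕ⇒inject₁≡suc , 1+j≢i ∘ sym ∘ toℕ⇒inject₁≡suc ]′ (adj-path i j adjacent)

  bar-inject₁ : ∀ i (j : Fin m) → bar S i (inject₁ j) ≡ does (i ≟ inject₁ j) xor does (i ≟ suc j)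
  bar-inject₁ = <-weakInduction P at-zero at-suc
    where
    P : Fin (suc m) → Set
    P i = ∀ j → bar S i (inject₁ j) ≡ does (i ≟ inject₁ j) xor does (i ≟ suc j)
    at-zero : P zero
    at-zero zero    = refl
    at-zero (suc j) = refl
    at-suc : ∀ i → P (inject₁ i) → P (suc i)
    at-suc i ih j = begin
        bar S (suc i) (inject₁ j)
      ≡⟨ bar-suc i (inject₁ j) ⟩
        bar S (inject₁ i) (inject₁ j) xor (adj (inject₁ j) (inject₁ i) ∧ bar S (inject₁ i) (inject₁ i))
      ≡⟨ cong₂ (λ x y → x xor (y ∧ bar S (inject₁ i) (inject₁ i))) (ih j) (adj-inject₁ j i) ⟩
        previous xor (consecutive j i ∧ bar S (inject₁ i) (inject₁ i))
      ≡⟨ cong (λ z → previous xor (consecutive j i ∧ z)) (trans (ih i) (does-diagonal i)) ⟩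
        previous xor (consecutive j i ∧ true)
      ≡⟨ cong (previous xor_) (∧-identityʳ (consecutive j i)) ⟩
        previous xor consecutive j i
      ≡⟨ does-path-step i j ⟩
        does (suc i ≟ inject₁ j) xor does (suc i ≟ suc j) ∎
      where
      previous : Bool
      previous = does (inject₁ i ≟ inject₁ j) xor does (inject₁ i ≟ suc j)

  bar-diagonal : ∀ i → bar S (inject₁ i) (inject₁ i) ≡ true
  bar-diagonal i = trans (bar-inject₁ (inject₁ i) i) (does-diagonal i)

  sumOver-bar-inject₁ : ∀ D j → sumOver D (bar S) (inject₁ j) ≡ D (inject₁ j) xor D (suc j)
  sumOver-bar-inject₁ D j = begin
      Σ₂ (λ i → D i ∧ bar S i (inject₁ j))
    ≡⟨ Σ₂-cong (λ i → trans (cong (D i ∧_) (bar-inject₁ i j))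
                            (∧-distribˡ-xor (D i) (does (i ≟ inject₁ j)) (does (i ≟ suc j)))) ⟩
      Σ₂ (λ i → (D i ∧ does (i ≟ inject₁ j)) xor (D i ∧ does (i ≟ suc j)))
    ≡⟨ Σ₂-xor (λ i → D i ∧ does (i ≟ inject₁ j)) (λ i → D i ∧ does (i ≟ suc j)) ⟩
      Σ₂ (λ i → D i ∧ does (i ≟ inject₁ j)) xor Σ₂ (λ i → D i ∧ does (i ≟ suc j))
    ≡⟨ cong₂ _xor_ (dot-χ (inject₁ j)) (dot-χ (suc j)) ⟩
      D (inject₁ j) xor D (suc j) ∎
    where
    dot-χ : ∀ c → Σ₂ (λ i → D i ∧ does (i ≟ c)) ≡ D c
    dot-χ c = trans (Σ₂-cong λ i → cong (D i ∧_) (sym (isYes≗does (i ≟ c)))) (⟨-,χ⟩ D c)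

  sumOver-bar-sn : ∀ D → sumOver D (bar S) (sn S) ≡ Σ₂ (λ i → inΠ₁ S i ∧ D i)
  sumOver-bar-sn D = Σ₂-cong λ i → trans (cong (D i ∧_) (sym (⟨-,χ⟩ (bar S i) (sn S)))) (∧-comm (D i) _)

  inΠ₁-suc : ∀ j → inΠ₁ S (suc j) ≡ inΠ₁ S (inject₁ j) xor adj (inject₁ j) (sn S)
  inΠ₁-suc j = begin
      inΠ₁ S (suc j)
    ≡⟨ ⟨-,χ⟩ (bar S (suc j)) (sn S) ⟩
      bar S (suc j) (sn S)
    ≡⟨ bar-suc j (sn S) ⟩
      bar S (inject₁ j) (sn S) xor (adj (sn S) (inject₁ j) ∧ bar S (inject₁ j) (inject₁ j))
    ≡⟨ cong₂ (λ x y → x xor (y ∧ bar S (inject₁ j) (inject₁ j)))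
             (sym (⟨-,χ⟩ (bar S (inject₁ j)) (sn S))) (adj-sym (sn S) (inject₁ j)) ⟩
      inΠ₁ S (inject₁ j) xor (adj (inject₁ j) (sn S) ∧ bar S (inject₁ j) (inject₁ j))
    ≡⟨ cong (λ y → inΠ₁ S (inject₁ j) xor (adj (inject₁ j) (sn S) ∧ y)) (bar-diagonal j) ⟩
      inΠ₁ S (inject₁ j) xor (adj (inject₁ j) (sn S) ∧ true)
    ≡⟨ cong (inΠ₁ S (inject₁ j) xor_) (∧-identityʳ _) ⟩
      inΠ₁ S (inject₁ j) xor adj (inject₁ j) (sn S) ∎

  sumΠ₀≡adj-sn : ∀ a → sumΠ₀ S a ≡ adj a (sn S)
  sumΠ₀≡adj-sn a with last-or-inject₁ a
  ... | inj₁ refl = begin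
      sumOver (not ∘ inΠ₁ S) (bar S) (sn S)
    ≡⟨ sumOver-bar-sn (not ∘ inΠ₁ S) ⟩
      Σ₂ (λ i → inΠ₁ S i ∧ not (inΠ₁ S i))
    ≡⟨ Σ₂-cong (∧-inverseʳ ∘ inΠ₁ S) ⟩
      Σ₂ {suc m} (λ _ → false)
    ≡⟨ Σ₂-false (suc m) ⟩
      false
    ≡⟨ adj-irrefl (sn S) ⟨
      adj (sn S) (sn S) ∎
  ... | inj₂ (j , refl) = begin
      sumΠ₀ S (inject₁ j)
    ≡⟨ sumOver-bar-inject₁ (not ∘ inΠ₁ S) j ⟩
      not (inΠ₁ S (inject₁ j)) xor not (inΠ₁ S (suc j))
    ≡⟨ cong (λ y → not (inΠ₁ S (inject₁ j)) xor not y) (inΠ₁-suc j) ⟩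
      not (inΠ₁ S (inject₁ j)) xor not (inΠ₁ S (inject₁ j) xor adj (inject₁ j) (sn S))
    ≡⟨ not-xor-not-xor (inΠ₁ S (inject₁ j)) _ ⟩
      adj (inject₁ j) (sn S) ∎
    where
    not-xor-not-xor : ∀ x y → not x xor not (x xor y) ≡ y
    not-xor-not-xor true  y = not-involutive y
    not-xor-not-xor false y = not-involutive y

  module _ (Π₁-odd : ¬ 2 ∣ count (inΠ₁ S)) where

    bar-independent : ∀ E → (∀ a → sumOver E (bar S) a ≡ false) → ∀ i → E i ≡ false
    bar-independent E E↦0 i = trans (E-constant i) E₀≡false
      where
      E-constant : ∀ i → E i ≡ E zero
      E-constant = <-weakInduction (λ i → E i ≡ E zero) refl λ j ih →
        trans (sym (xor≡false⇒≡ (trans (sym (sumOver-bar-inject₁ E j)) (E↦0 (inject₁ j))))) ih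
      E₀≡false : E zero ≡ false
      E₀≡false = begin
          E zero
        ≡⟨ cong (_∧ E zero) (Σ₂-odd (inΠ₁ S) Π₁-odd) ⟨
          Σ₂ (inΠ₁ S) ∧ E zero
        ≡⟨ F₂Σ*.*-distribʳ-sum (E zero) (inΠ₁ S) ⟩
          Σ₂ (λ i → inΠ₁ S i ∧ E zero)
        ≡⟨ Σ₂-cong (λ i → cong (inΠ₁ S i ∧_) (E-constant i)) ⟨
          Σ₂ (λ i → inΠ₁ S i ∧ E i)
        ≡⟨ sumOver-bar-sn E ⟨
          sumOver E (bar S) (sn S)
        ≡⟨ E↦0 (sn S) ⟩
          false ∎

    bar-coordinates-unique : ∀ D D' → (∀ a → sumOver D (bar S) a ≡ sumOver D' (bar S) a) → D ≗ D'
    bar-coordinates-unique D D' same =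
      xor≡false⇒≡ ∘ bar-independent (λ i → D i xor D' i) λ a →
        trans (sumOver-xor D D' (bar S) a)
              (trans (cong (_xor sumOver D' (bar S) a) (same a)) (xor-same (sumOver D' (bar S) a)))

    sw-unique : ∀ D D' {v : Vec₂ (suc m)} →
                (∀ a → sumOver D (bar S) a ≡ v a) → (∀ a → sumOver D' (bar S) a ≡ v a) → count D ≡ count D'
    sw-unique D D' D↦v D'↦v = count-cong (bar-coordinates-unique D D' λ a → trans (D↦v a) (sym (D'↦v a)))

  flip-sn : ∀ (u D : Vec₂ (suc m)) → (∀ a → sumOver D (bar S) a ≡ u a) →
            ∀ a → (flipMat S (sn S) · u) a ≡ u a xor (adj a (sn S) ∧ Σ₂ (λ i → inΠ₁ S i ∧ D i))
  flip-sn u D D↦u a = trans (flip-· (sn S) u a)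
    (cong (λ b → u a xor (adj a (sn S) ∧ b)) (trans (sym (D↦u (sn S))) (sumOver-bar-sn D)))

  flip-sn-even : ∀ {u : Vec₂ (suc m)} D → (∀ a → sumOver D (bar S) a ≡ u a) →
                 2 ∣ count (λ i → inΠ₁ S i ∧ D i) → ∀ a → (flipMat S (sn S) · u) a ≡ u a
  flip-sn-even {u} D D↦u k-even a = begin
      (flipMat S (sn S) · u) a
    ≡⟨ flip-sn u D D↦u a ⟩
      u a xor (adj a (sn S) ∧ Σ₂ (λ i → inΠ₁ S i ∧ D i))
    ≡⟨ cong (λ b → u a xor (adj a (sn S) ∧ b)) (Σ₂-even (λ i → inΠ₁ S i ∧ D i) k-even) ⟩
      u a xor (adj a (sn S) ∧ false)
    ≡⟨ cong (u a xor_) (∧-zeroʳ (adj a (sn S))) ⟩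
      u a xor false
    ≡⟨ xor-identityʳ (u a) ⟩
      u a ∎

  flip-sn-odd : ∀ {u : Vec₂ (suc m)} D → (∀ a → sumOver D (bar S) a ≡ u a) →
                ¬ 2 ∣ count (λ i → inΠ₁ S i ∧ D i) → ∀ a → (flipMat S (sn S) · u) a ≡ (u +ᵥ sumΠ₀ S) a
  flip-sn-odd {u} D D↦u k-odd a = begin
      (flipMat S (sn S) · u) a
    ≡⟨ flip-sn u D D↦u a ⟩
      u a xor (adj a (sn S) ∧ Σ₂ (λ i → inΠ₁ S i ∧ D i))
    ≡⟨ cong (λ b → u a xor (adj a (sn S) ∧ b)) (Σ₂-odd (λ i → inΠ₁ S i ∧ D i) k-odd) ⟩
      u a xor (adj a (sn S) ∧ true)
    ≡⟨ cong (u a xor_) (trans (∧-identityʳ (adj a (sn S))) (sym (sumΠ₀≡adj-sn a))) ⟩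
      u a xor sumΠ₀ S a ∎

lemma5p1 : (m : ℕ) → 1 ≤ m → (S : SGraph m) →
    ¬ (2 ∣ count (inΠ₁ S)) →
    (u : Fin (suc m) → Bool) → (Δu : Fin (suc m) → Bool) →
    (∀ a → sumOver Δu (bar S) a ≡ u a) →
    ((2 ∣ count (λ i → inΠ₁ S i ∧ Δu i)) →
       (∀ a → (flipMat S (sn S) · u) a ≡ u a)
       × (∀ (Δsu : Fin (suc m) → Bool) →
            (∀ a → sumOver Δsu (bar S) a ≡ (flipMat S (sn S) · u) a) →
            count Δsu ≡ count Δu))
    × (¬ (2 ∣ count (λ i → inΠ₁ S i ∧ Δu i)) →
       (∀ a → (flipMat S (sn S) · u) a ≡ (u +ᵥ sumΠ₀ S) a)
       × (∀ (Δsu : Fin (suc m) → Bool) →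
            (∀ a → sumOver Δsu (bar S) a ≡ (flipMat S (sn S) · u) a) →
            count Δsu ≡ suc m ∸ count (inΠ₁ S) + 2 * count (λ i → inΠ₁ S i ∧ Δu i) ∸ count Δu))
lemma5p1 m _ S Π₁-odd u Δu Δu↦u =
    (λ k-even → let fixes = flip-sn-even S Δu Δu↦u k-even in
      fixes , λ Δsu Δsu↦su →
        sw-unique S Π₁-odd Δsu Δu Δsu↦su (λ a → trans (Δu↦u a) (sym (fixes a))))
  , (λ k-odd → let adds = flip-sn-odd S Δu Δu↦u k-odd in
      adds , λ Δsu Δsu↦su →
        trans (sw-unique S Π₁-odd Δsu Δu+Π₀ Δsu↦su (λ a → trans (Δu+Π₀↦u+sumΠ₀ a) (sym (adds a))))
              (m+n+o≡p+2q⇒m≡p∸o+2q∸n {q = k} (count-xor-not Δu (inΠ₁ S)) (count≤n (inΠ₁ S))))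
  where
  k : ℕ
  k = count (λ i → inΠ₁ S i ∧ Δu i)
  Δu+Π₀ : Vec₂ (suc m)
  Δu+Π₀ i = Δu i xor not (inΠ₁ S i)
  Δu+Π₀↦u+sumΠ₀ : ∀ a → sumOver Δu+Π₀ (bar S) a ≡ (u +ᵥ sumΠ₀ S) a
  Δu+Π₀↦u+sumΠ₀ a = trans (sumOver-xor Δu (not ∘ inΠ₁ S) (bar S) a) (cong (_xor sumΠ₀ S a) (Δu↦u a))
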